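{- Let $k,r\ge1$ and $0\le m\le kr$ be integers, and let $S$ be a set of $m$ index pairs $(i,j)$ with $1\le i\le k$, $1\le j\le r$. For $(i,j)\in S$ let $V_{i,j}=\mathbb{E}_4\times\mathbb{E}_2$, and let $f_{i,j},g_{i,j}:V_{i,j}\to\mathbb{E}_2$ be such that $\{(\bar x,f_{i,j}(\bar x),g_{i,j}(\bar x)):\bar x\in V_{i,j}\}$ is a $1$-perfect code in the Doob graph $D(1,3)$ (vertex set $\mathbb{E}_4\times\mathbb{E}_2^3$). For $(i,j)\notin S$ let $V_{i,j}=\mathbb{E}_2^3$ and let $f_{i,j},g_{i,j}:V_{i,j}\to\mathbb{E}_2$ be such that $\{(\bar x,f_{i,j}(\bar x),g_{i,j}(\bar x)):\bar x\in \mathbb{E}_2^3\}$ is a $1$-perfect code in the Hamming graph $H(5,4)$ (vertex set $\mathbb{E}_2^5$). For $\bar{\bar x}=(\bar x_{1,1},\dots,\bar x_{k,r})\in\prod_{i,j}V_{i,j}$ define $$f(\bar{\bar x})=\Big(\sum_{j=1}^r f_{1,j}(\bar x_{1,j}),\dots,\sum_{j=1}^r f_{k,j}(\bar x_{k,j})\Big)\in\mathbb{E}_2^k,\qquad g(\bar{\bar x})=\Big(\sum_{i=1}^k g_{i,1}(\bar x_{i,1}),\dots,\sum_{i=1}^k g_{i,r}(\bar x_{i,r})\Big)\in\mathbb{E}_2^r.$$ Let $C'\subseteq\mathbb{E}_2^k$ and $C''\subseteq\mathbb{E}_2^r$ be $1$-perfect codes with respect to the Hamming metric. Then $$C=\{(\bar{\bar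 x},\,f(\bar{\bar x})+c',\,g(\bar{\bar x})+c''):\ \bar{\bar x}\in\textstyle\prod_{i,j}V_{i,j},\ c'\in C',\ c''\in C''\}$$ is a $1$-perfect code in the graph $(\mathrm{Sh}\times K)^m\times(K^3)^{kr-m}\times K^k\times K^r$ (each $V_{i,j}$ with $(i,j)\in S$ carrying $\mathrm{Sh}\times K$, each other $V_{i,j}$ carrying $K^3$, followed by $K^k$ on the $\mathbb{E}_2^k$ part and $K^r$ on the $\mathbb{E}_2^r$ part).
   Context: $\mathbb{E}$ denotes the Eisenstein integers $\{a+b\omega\}$, $\omega=e^{2\pi i/3}$, $\bar\omega=\omega^2$; $\mathbb{E}_4=\mathbb{E}/4\mathbb{E}$, $\mathbb{E}_2=\mathbb{E}/2\mathbb{E}=\mathrm{GF}(4)$. $\mathrm{Sh}$ (Shrikhande graph) is the Cayley graph of $(\mathbb{E}_4,+)$ with generating set $\{\pm1,\pm\omega,\pm\bar\omega\}$; $K$ is the complete graph on $4$ vertices, realized as the Cayley graph of $(\mathbb{E}_2,+)$ with generating set $\{1,\omega,\bar\omega\}$. Products of graphs are Cartesian products; $D(1,3)=\mathrm{Sh}\times K^3$ and $H(5,4)=K^5$. The Hamming metric on $\mathbb{E}_2^t$ is the distance of $K^t$. A $1$-perfect code is a vertex set whose radius-$1$ balls partition the vertex set. -}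

module Defs where

open import Data.Bool using (Bool; true; false; _xor_; if_then_else_)
open import Data.Nat using (ℕ; zero; suc; _+_)
open import Data.Nat.DivMod using (_mod_)
open import Data.Fin using (Fin; toℕ) renaming (zero to fz; suc to fs)
open import Data.Vec using (Vec; lookup; tabulate; zipWith)
open import Data.Product using (Σ; _×_; _,_)
open import Data.Sum using (_⊎_)
open import Data.List using (List; []; _∷_)
open import Data.List.Membership.Propositional using (_∈_)
open import Relation.Binary.PropositionalEquality using (_≡_; _≢_)

-- Graphs: a vertex type, an equality on vertices (propositional for the
-- basic graphs, pointwise for products of families, so that no function
-- extensionality is needed), and an adjacency relation.

record Graph : Set₁ where
  field
    V   : Set
    _≈_ : V → V → Set
    _~_ : V → V → Set
open Graph public

Cayley : (A : Set) → (A → A → A) → List A → Graph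
Cayley A _+_ gens = record
  { V = A ; _≈_ = _≡_ ; _~_ = λ x y → Σ A (λ s → s ∈ gens × y ≡ x + s) }

_×ᴳ_ : Graph → Graph → Graph
G ×ᴳ H = record
  { V = V G × V H
  ; _≈_ = λ { (a , b) (a' , b') → _≈_ G a a' × _≈_ H b b' }
  ; _~_ = λ { (a , b) (a' , b') →
        (_~_ G a a' × _≈_ H b b') ⊎ (_≈_ G a a' × _~_ H b b') }
  }
infixl 6 _×ᴳ_

Πᴳ : (n : ℕ) → (Fin n → Graph) → Graph
Πᴳ n G = record
  { V = (i : Fin n) → V (G i)
  ; _≈_ = λ x y → (i : Fin n) → _≈_ (G i) (x i) (y i)
  ; _~_ = λ x y → Σ (Fin n) (λ i →
        _~_ (G i) (x i) (y i) × ((j : Fin n) → j ≢ i → _≈_ (G j) (x j) (y j)))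
  }

Ball₁ : (G : Graph) → V G → V G → Set
Ball₁ G c v = _≈_ G c v ⊎ _~_ G c v

IsPerfect1 : (G : Graph) → (V G → Set) → Set
IsPerfect1 G C = (v : V G) → Σ (V G) (λ c → (C c × Ball₁ G c v) ×
                   ((c' : V G) → C c' → Ball₁ G c' v → _≈_ G c' c))

-- E₂ = GF(4) = E/2E, elements a + bω with a,b ∈ {0,1} encoded as (a , b).

E₂ : Set
E₂ = Bool × Bool

_+₂_ : E₂ → E₂ → E₂
(a , b) +₂ (c , d) = (a xor c , b xor d)

0₂ 1₂ ω₂ ω̄₂ : E₂
0₂ = (false , false)
1₂ = (true , false)
ω₂ = (false , true)
ω̄₂ = (true , true)     -- ω̄ = -1-ω ≡ 1 + ω (mod 2)

K : Graph
K = Cayley E₂ _+₂_ (1₂ ∷ ω₂ ∷ ω̄₂ ∷ [])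

E₂^ : ℕ → Set
E₂^ n = Vec E₂ n

_⊕_ : {n : ℕ} → E₂^ n → E₂^ n → E₂^ n
_⊕_ = zipWith _+₂_

Kpow : ℕ → Graph
Kpow n = record
  { V = E₂^ n
  ; _≈_ = _≡_
  ; _~_ = λ u v → Σ (Fin n) (λ i →
        _~_ K (lookup u i) (lookup v i) × ((j : Fin n) → j ≢ i → lookup u j ≡ lookup v j))
  }

Σ₂ : (n : ℕ) → (Fin n → E₂) → E₂
Σ₂ zero    h = 0₂
Σ₂ (suc n) h = h fz +₂ Σ₂ n (λ i → h (fs i))

-- E₄ = E/4E, elements a + bω with a,b ∈ Z/4 encoded as (a , b).

Z₄ : Set
Z₄ = Fin 4

_+₄_ : Z₄ → Z₄ → Z₄
a +₄ b = (toℕ a + toℕ b) mod 4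

E₄ : Set
E₄ = Z₄ × Z₄

_+E₄_ : E₄ → E₄ → E₄
(a , b) +E₄ (c , d) = (a +₄ c , b +₄ d)

-- generators ±1, ±ω, ±ω̄  (ω̄ = -1-ω = 3 + 3ω, -ω̄ = 1 + ω)
ShGens : List E₄
ShGens = (1 mod 4 , 0 mod 4) ∷ (3 mod 4 , 0 mod 4)
       ∷ (0 mod 4 , 1 mod 4) ∷ (0 mod 4 , 3 mod 4)
       ∷ (3 mod 4 , 3 mod 4) ∷ (1 mod 4 , 1 mod 4) ∷ []

Sh : Graph
Sh = Cayley E₄ _+E₄_ ShGens

Gsel : Bool → Graph
Gsel true  = Sh ×ᴳ K
Gsel false = Kpow 3

GraphCode : (G : Graph) → (V G → E₂) → (V G → E₂) → V (G ×ᴳ K ×ᴳ K) → Set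
GraphCode G f g ((x , a) , b) = (a ≡ f x) × (b ≡ g x)

sumℕ : (n : ℕ) → (Fin n → ℕ) → ℕ
sumℕ zero    h = 0
sumℕ (suc n) h = h fz + sumℕ n (λ i → h (fs i))

countS : (k r : ℕ) → (Fin k → Fin r → Bool) → ℕ
countS k r S = sumℕ k (λ i → sumℕ r (λ j → if S i j then 1 else 0))

module Submission where

-- Write a vertex of the big graph as (x , u , w) with x a grid of
-- local coordinates x i j, u ∈ E₂^k and w ∈ E₂^r, and put F x = row sums of f
-- and G x = column sums of g.  Its two syndromes are F x + u and G x + w, and
-- (x , u , w) is a codeword exactly when both syndromes are codewords of C′, C″.
--
-- The local hypothesis says that y ↦ (f y + f x , g y + g x) maps the
-- neighbours of x injectively to pairs of nonzero elements and hits all such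
-- pairs.  Moving along one edge of the grid at cell (i , j) therefore changes
-- the first syndrome in coordinate i only and the second in coordinate j only,
-- both by nonzero amounts.  Hence a ball around v in the big graph maps into the
-- balls around the syndromes of v, which gives the packing property from that of
-- C′ and C″; and the four ways the syndromes of v can sit relative to their
-- nearest codewords (equal/adjacent, twice) give the covering property.

open import Defs
open import Data.Bool using (Bool)
open import Data.Nat using (ℕ; _≤_)
open import Data.Fin using (Fin)
open import Data.Vec using (tabulate)
open import Data.Product using (Σ; _×_; _,_)
open import Relation.Binary.PropositionalEquality using (_≡_)

open import Data.Bool using (true; false)
open import Data.Nat using (zero; suc)
open import Data.Bool.Properties using (xor-assoc; xor-comm; xor-same) renaming (_≟_ to _≟ᴮ_)
open import Data.Nat.DivMod using (_mod_)
open import Data.Fin using () renaming (zero to fz; suc to fs)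
open import Data.Fin.Properties using (_≟_; suc-injective)
open import Data.Vec using ([]; _∷_; lookup)
open import Data.Vec.Properties using (lookup-zipWith; lookup∘tabulate; tabulate∘lookup; tabulate-cong)
open import Data.Product using (proj₁; proj₂)
open import Data.Product.Properties using (≡-dec)
open import Data.Sum using (_⊎_; inj₁; inj₂)
open import Data.List using (List; []; _∷_)
open import Data.List.Membership.Propositional using (_∈_)
open import Data.List.Relation.Unary.Any using (here; there)
open import Data.Empty using (⊥; ⊥-elim)
open import Relation.Nullary using (¬_; Dec; yes; no)
open import Relation.Binary.PropositionalEquality using (_≢_; refl; sym; trans; cong; cong₂; subst; subst₂; module ≡-Reasoning)

open ≡-Reasoning

+₂-assoc : ∀ a b c → (a +₂ b) +₂ c ≡ a +₂ (b +₂ c)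
+₂-assoc (a , a′) (b , b′) (c , c′) = cong₂ _,_ (xor-assoc a b c) (xor-assoc a′ b′ c′)

+₂-comm : ∀ a b → a +₂ b ≡ b +₂ a
+₂-comm (a , a′) (b , b′) = cong₂ _,_ (xor-comm a b) (xor-comm a′ b′)

+₂-self : ∀ a → a +₂ a ≡ 0₂
+₂-self (a , a′) = cong₂ _,_ (xor-same a) (xor-same a′)

+₂-cancelˡ : ∀ a b → a +₂ (a +₂ b) ≡ b
+₂-cancelˡ a b = begin
  a +₂ (a +₂ b)  ≡⟨ +₂-assoc a a b ⟨
  (a +₂ a) +₂ b  ≡⟨ cong (_+₂ b) (+₂-self a) ⟩
  b              ∎

+₂-cancelʳ : ∀ a b → (b +₂ a) +₂ a ≡ b
+₂-cancelʳ a b = begin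
  (b +₂ a) +₂ a  ≡⟨ +₂-comm (b +₂ a) a ⟩
  a +₂ (b +₂ a)  ≡⟨ cong (a +₂_) (+₂-comm b a) ⟩
  a +₂ (a +₂ b)  ≡⟨ +₂-cancelˡ a b ⟩
  b              ∎

+₂-injectiveˡ : ∀ {a b c} → a +₂ b ≡ a +₂ c → b ≡ c
+₂-injectiveˡ {a} {b} {c} e = trans (sym (+₂-cancelˡ a b)) (trans (cong (a +₂_) e) (+₂-cancelˡ a c))

+₂-injectiveʳ : ∀ {a b c} → a +₂ c ≡ b +₂ c → a ≡ b
+₂-injectiveʳ {a} {b} {c} e = trans (sym (+₂-cancelʳ c a)) (trans (cong (_+₂ c) e) (+₂-cancelʳ c b))

move-summand : ∀ {a b d} → b ≡ a +₂ d → a ≡ b +₂ d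
move-summand {a} {d = d} refl = sym (+₂-cancelʳ d a)

difference : ∀ {a b d} → b ≡ a +₂ d → b +₂ a ≡ d
difference {a} {d = d} refl = trans (+₂-comm (a +₂ d) a) (+₂-cancelˡ a d)

zero-difference : ∀ {a b} → a +₂ b ≡ 0₂ → a ≡ b
zero-difference {a} {b} e = trans (sym (+₂-cancelʳ b a)) (cong (_+₂ b) e)

unmoved⇒zero : ∀ {a d} → a ≡ a +₂ d → d ≡ 0₂
unmoved⇒zero {a} e = trans (sym (difference e)) (+₂-self a)

_≟₂_ : (a b : E₂) → Dec (a ≡ b)
_≟₂_ = ≡-dec _≟ᴮ_ _≟ᴮ_

lookup-⊕ : ∀ {n} (u v : E₂^ n) i → lookup (u ⊕ v) i ≡ lookup u i +₂ lookup v i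
lookup-⊕ u v i = lookup-zipWith _+₂_ i u v

⊕-cancelˡ : ∀ {n} (t u : E₂^ n) → t ⊕ (t ⊕ u) ≡ u
⊕-cancelˡ []      []      = refl
⊕-cancelˡ (a ∷ t) (b ∷ u) = cong₂ _∷_ (+₂-cancelˡ a b) (⊕-cancelˡ t u)

⊕-injectiveʳ : ∀ {n} {t u u′ : E₂^ n} → t ⊕ u ≡ t ⊕ u′ → u ≡ u′
⊕-injectiveʳ {t = t} {u} {u′} e = trans (sym (⊕-cancelˡ t u)) (trans (cong (t ⊕_) e) (⊕-cancelˡ t u′))

lookup-extensionality : ∀ {n} {u v : E₂^ n} → (∀ i → lookup u i ≡ lookup v i) → u ≡ v
lookup-extensionality {u = u} {v} p = trans (sym (tabulate∘lookup u)) (trans (tabulate-cong p) (tabulate∘lookup v))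

record Step {n} (i : Fin n) (d : E₂) (u v : E₂^ n) : Set where
  constructor step
  field
    moved : lookup v i ≡ lookup u i +₂ d
    fixed : (j : Fin n) → j ≢ i → lookup u j ≡ lookup v j

step-sym : ∀ {n i d} {u v : E₂^ n} → Step i d u v → Step i d v u
step-sym (step moved fixed) = step (move-summand moved) λ j j≢i → sym (fixed j j≢i)

step-translateˡ : ∀ {n i d} {u v : E₂^ n} (t : E₂^ n) → Step i d u v → Step i d (t ⊕ u) (t ⊕ v)
step-translateˡ {i = i} {d} {u} {v} t (step moved fixed) = step moved′ fixed′
  where
  moved′ : lookup (t ⊕ v) i ≡ lookup (t ⊕ u) i +₂ d
  moved′ = begin
    lookup (t ⊕ v) i                   ≡⟨ lookup-⊕ t v i ⟩
    lookup t i +₂ lookup v i           ≡⟨ cong (lookup t i +₂_) moved ⟩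
    lookup t i +₂ (lookup u i +₂ d)    ≡⟨ +₂-assoc (lookup t i) (lookup u i) d ⟨
    (lookup t i +₂ lookup u i) +₂ d    ≡⟨ cong (_+₂ d) (lookup-⊕ t u i) ⟨
    lookup (t ⊕ u) i +₂ d              ∎
  fixed′ : ∀ j → j ≢ i → lookup (t ⊕ u) j ≡ lookup (t ⊕ v) j
  fixed′ j j≢i = trans (lookup-⊕ t u j) (trans (cong (lookup t j +₂_) (fixed j j≢i)) (sym (lookup-⊕ t v j)))

step-translateʳ : ∀ {n i d} {u v : E₂^ n} (t : E₂^ n) → Step i d u v → Step i d (u ⊕ t) (v ⊕ t)
step-translateʳ {i = i} {d} {u} {v} t i-step = subst₂ (Step i d) (⊕-comm t u) (⊕-comm t v) (step-translateˡ t i-step)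
  where
  ⊕-comm : ∀ {n} (a b : E₂^ n) → a ⊕ b ≡ b ⊕ a
  ⊕-comm a b = lookup-extensionality λ j →
    trans (lookup-⊕ a b j) (trans (+₂-comm (lookup a j) (lookup b j)) (sym (lookup-⊕ b a j)))

step-determined : ∀ {n i d} {u v v′ : E₂^ n} → Step i d u v → Step i d u v′ → v ≡ v′
step-determined {i = i} {v = v} {v′} (step moved fixed) (step moved′ fixed′) = lookup-extensionality same
  where
  same : ∀ j → lookup v j ≡ lookup v′ j
  same j with j ≟ i
  ... | yes refl = trans moved (sym moved′)
  ... | no j≢i   = trans (sym (fixed j j≢i)) (fixed′ j j≢i)

step-moves : ∀ {n i d} {u v : E₂^ n} → d ≢ 0₂ → Step i d u v → u ≢ v
step-moves d≢0 (step moved _) refl = d≢0 (unmoved⇒zero moved)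

step-unique : ∀ {n i i′ d d′} {u v : E₂^ n} → d ≢ 0₂ → Step i d u v → Step i′ d′ u v → i ≡ i′ × d ≡ d′
step-unique {i = i} {i′} {u = u} d≢0 (step moved _) (step moved′ fixed′) with i ≟ i′
... | yes refl = refl , +₂-injectiveˡ {lookup u i} (trans (sym moved) moved′)
... | no i≢i′  = ⊥-elim (d≢0 (unmoved⇒zero (trans (fixed′ i i≢i′) moved)))

KGens : List E₂
KGens = 1₂ ∷ ω₂ ∷ ω̄₂ ∷ []

gen⇒nonzero : ∀ {s} → s ∈ KGens → s ≢ 0₂
gen⇒nonzero (here refl) ()
gen⇒nonzero (there (here refl)) ()
gen⇒nonzero (there (there (here refl))) ()

nonzero⇒gen : ∀ s → s ≢ 0₂ → s ∈ KGens
nonzero⇒gen (false , false) s≢0 = ⊥-elim (s≢0 refl)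
nonzero⇒gen (true  , false) _   = here refl
nonzero⇒gen (false , true)  _   = there (here refl)
nonzero⇒gen (true  , true)  _   = there (there (here refl))

K-adjacent : ∀ {a b} → a ≢ b → _~_ K a b
K-adjacent {a} {b} a≢b = a +₂ b , nonzero⇒gen _ (λ e → a≢b (zero-difference e)) , sym (+₂-cancelˡ a b)

K-ball : ∀ a b → Ball₁ K a b
K-ball a b with a ≟₂ b
... | yes a≡b = inj₁ a≡b
... | no a≢b  = inj₂ (K-adjacent a≢b)

Kpow-adjacent : ∀ {n i d} {u v : E₂^ n} → d ≢ 0₂ → Step i d u v → _~_ (Kpow n) u v
Kpow-adjacent {i = i} {d} d≢0 (step moved fixed) = i , (d , nonzero⇒gen d d≢0 , moved) , fixed

Kpow-adjacent⁻¹ : ∀ {n} {u v : E₂^ n} → _~_ (Kpow n) u v → Σ (Fin n) λ i → Σ E₂ λ d → d ≢ 0₂ × Step i d u v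
Kpow-adjacent⁻¹ (i , (d , d∈ , moved) , fixed) = i , d , gen⇒nonzero d∈ , step moved fixed

Kpow-translate : ∀ {n} {u v : E₂^ n} (t : E₂^ n) → _~_ (Kpow n) u v → _~_ (Kpow n) (t ⊕ u) (t ⊕ v)
Kpow-translate t adj with Kpow-adjacent⁻¹ adj
... | _ , _ , d≢0 , i-step = Kpow-adjacent d≢0 (step-translateˡ t i-step)

record Discrete (G : Graph) : Set where
  field
    ≈⇒≡    : ∀ {a b} → _≈_ G a b → a ≡ b
    ≈-refl : ∀ {a} → _≈_ G a a
open Discrete

≡⇒≈ : ∀ {G} → Discrete G → ∀ {a b} → a ≡ b → _≈_ G a b
≡⇒≈ G-discrete refl = ≈-refl G-discrete

Loopless : Graph → Set
Loopless G = ∀ {a} → ¬ _~_ G a a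

Cayley-discrete : ∀ A _+_ gens → Discrete (Cayley A _+_ gens)
Cayley-discrete A _+_ gens = record { ≈⇒≡ = λ e → e ; ≈-refl = refl }

K-discrete : Discrete K
K-discrete = Cayley-discrete E₂ _+₂_ KGens

Kpow-discrete : ∀ n → Discrete (Kpow n)
Kpow-discrete n = record { ≈⇒≡ = λ e → e ; ≈-refl = refl }

×ᴳ-discrete : ∀ {G H} → Discrete G → Discrete H → Discrete (G ×ᴳ H)
×ᴳ-discrete G-discrete H-discrete = record
  { ≈⇒≡    = λ (p , q) → cong₂ _,_ (≈⇒≡ G-discrete p) (≈⇒≡ H-discrete q)
  ; ≈-refl = ≈-refl G-discrete , ≈-refl H-discrete
  }

×ᴳ-loopless : ∀ {G H} → Loopless G → Loopless H → Loopless (G ×ᴳ H)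
×ᴳ-loopless G-loopless H-loopless (inj₁ (loop , _)) = G-loopless loop
×ᴳ-loopless G-loopless H-loopless (inj₂ (_ , loop)) = H-loopless loop

K-loopless : Loopless K
K-loopless (s , s∈ , e) = gen⇒nonzero s∈ (unmoved⇒zero e)

Kpow-loopless : ∀ n → Loopless (Kpow n)
Kpow-loopless n {a} (i , loop , _) = K-loopless {lookup a i} loop

+₄-moves-1 : (a : Z₄) → a ≢ a +₄ (1 mod 4)
+₄-moves-1 fz ()
+₄-moves-1 (fs fz) ()
+₄-moves-1 (fs (fs fz)) ()
+₄-moves-1 (fs (fs (fs fz))) ()

+₄-moves-3 : (a : Z₄) → a ≢ a +₄ (3 mod 4)
+₄-moves-3 fz ()
+₄-moves-3 (fs fz) ()
+₄-moves-3 (fs (fs fz)) ()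
+₄-moves-3 (fs (fs (fs fz))) ()

-- Each generator of Sh moves some component by ±1.
Sh-loopless : Loopless Sh
Sh-loopless (_ , here refl , e)                                 = +₄-moves-1 _ (cong proj₁ e)
Sh-loopless (_ , there (here refl) , e)                         = +₄-moves-3 _ (cong proj₁ e)
Sh-loopless (_ , there (there (here refl)) , e)                 = +₄-moves-1 _ (cong proj₂ e)
Sh-loopless (_ , there (there (there (here refl))) , e)         = +₄-moves-3 _ (cong proj₂ e)
Sh-loopless (_ , there (there (there (there (here refl)))) , e) = +₄-moves-3 _ (cong proj₁ e)
Sh-loopless (_ , there (there (there (there (there (here refl))))) , e) = +₄-moves-1 _ (cong proj₁ e)

Gsel-discrete : ∀ b → Discrete (Gsel b)
Gsel-discrete true  = ×ᴳ-discrete {Sh} {K} (Cayley-discrete E₄ _+E₄_ ShGens) K-discrete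
Gsel-discrete false = Kpow-discrete 3

Gsel-loopless : ∀ b → Loopless (Gsel b)
Gsel-loopless true  = ×ᴳ-loopless {Sh} {K} Sh-loopless K-loopless
Gsel-loopless false {a} = Kpow-loopless 3 {a}

covering+packing⇒perfect : ∀ {G C}
  → ((v : V G) → Σ (V G) λ c → C c × Ball₁ G c v)
  → (∀ {c c′ v} → C c → C c′ → Ball₁ G c v → Ball₁ G c′ v → _≈_ G c′ c)
  → IsPerfect1 G C
covering+packing⇒perfect covering packing v with covering v
... | c , c∈ , ball = c , (c∈ , ball) , λ c′ c′∈ ball′ → packing c∈ c′∈ ball ball′

perfect⇒packing : ∀ {G C} → Discrete G → IsPerfect1 G C
  → ∀ {c c′ v} → C c → C c′ → Ball₁ G c v → Ball₁ G c′ v → c ≡ c′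
perfect⇒packing G-discrete perfect {c} {c′} {v} c∈ c′∈ ball ball′ with perfect v
... | _ , _ , unique = trans (≈⇒≡ G-discrete (unique c c∈ ball)) (sym (≈⇒≡ G-discrete (unique c′ c′∈ ball′)))

-- If the graph {(x , f x , g x)} of (f , g) is a
-- 1-perfect code in G × K × K, then y ↦ (f y + f x , g y + g x) is a bijection
-- from the neighbours of x onto the pairs of nonzero elements of E₂.
module NeighbourhoodBijection
  (G : Graph) (G-discrete : Discrete G) (G-loopless : Loopless G)
  (f g : V G → E₂) (perfect : IsPerfect1 (G ×ᴳ K ×ᴳ K) (GraphCode G f g)) where

  private
    L : Graph
    L = G ×ᴳ K ×ᴳ K

  codeword : V G → V L
  codeword x = (x , f x) , g x

  codeword-unique : ∀ {x y} v → Ball₁ L (codeword x) v → Ball₁ L (codeword y) v → x ≡ y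
  codeword-unique v ball-x ball-y =
    cong (λ c → proj₁ (proj₁ c))
      (perfect⇒packing (×ᴳ-discrete {G ×ᴳ K} {K} (×ᴳ-discrete {G} {K} G-discrete K-discrete) K-discrete)
        perfect (refl , refl) (refl , refl) ball-x ball-y)

  ball-along-G : ∀ {x y} a b → _~_ G y x → Ball₁ L ((y , a) , b) ((x , a) , b)
  ball-along-G a b y~x = inj₂ (inj₁ (inj₁ (y~x , refl) , refl))

  ball-along-second : ∀ x a a′ b → Ball₁ L ((x , a) , b) ((x , a′) , b)
  ball-along-second x a a′ b with K-ball a a′
  ... | inj₁ a≡a′ = inj₁ ((≈-refl G-discrete , a≡a′) , refl)
  ... | inj₂ a~a′ = inj₂ (inj₁ (inj₂ (≈-refl G-discrete , a~a′) , refl))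

  ball-along-third : ∀ x a b b′ → Ball₁ L ((x , a) , b) ((x , a) , b′)
  ball-along-third x a b b′ with K-ball b b′
  ... | inj₁ b≡b′ = inj₁ ((≈-refl G-discrete , refl) , b≡b′)
  ... | inj₂ b~b′ = inj₂ (inj₂ ((≈-refl G-discrete , refl) , b~b′))

  -- Neighbours change f: otherwise (x , f x , g y) would lie in the balls of
  -- both codewords of x and y, forcing the loop y = x.
  neighbour-changes-f : ∀ {x y} → _~_ G y x → f y ≢ f x
  neighbour-changes-f {x} {y} y~x fy≡fx = G-loopless (subst (λ z → _~_ G z x) y≡x y~x)
    where
    y≡x : y ≡ x
    y≡x = codeword-unique ((x , f x) , g y)
      (subst (λ a → Ball₁ L ((y , a) , g y) ((x , f x) , g y)) (sym fy≡fx) (ball-along-G (f x) (g y) y~x))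
      (ball-along-third x (f x) (g x) (g y))

  neighbour-changes-g : ∀ {x y} → _~_ G y x → g y ≢ g x
  neighbour-changes-g {x} {y} y~x gy≡gx = G-loopless (subst (λ z → _~_ G z x) y≡x y~x)
    where
    y≡x : y ≡ x
    y≡x = codeword-unique ((x , f y) , g x)
      (subst (λ b → Ball₁ L ((y , f y) , b) ((x , f y) , g x)) (sym gy≡gx) (ball-along-G (f y) (g x) y~x))
      (ball-along-second x (f x) (f y) (g x))

  -- Every pair of nonzero shifts is realised by a neighbour: the codeword
  -- covering (x , f x + a , g x + c) cannot be x's own, so it is a neighbour's.
  neighbour-exists : ∀ x {a c} → a ≢ 0₂ → c ≢ 0₂
    → Σ (V G) λ y → _~_ G y x × f y ≡ f x +₂ a × g y ≡ g x +₂ c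
  neighbour-exists x {a} {c} a≢0 c≢0 with perfect ((x , f x +₂ a) , g x +₂ c)
  ... | ((y , _) , _) , ((refl , refl) , ball) , _ = from-cover ball
    where
    shift-vanishes : ∀ (h : V G → E₂) → _≈_ G y x → ∀ {d} → h y ≡ h x +₂ d → d ≡ 0₂
    shift-vanishes h y≈x {d} e = unmoved⇒zero (trans (cong h (sym (≈⇒≡ G-discrete y≈x))) e)

    from-cover : Ball₁ L ((y , f y) , g y) ((x , f x +₂ a) , g x +₂ c)
      → Σ (V G) λ y → _~_ G y x × f y ≡ f x +₂ a × g y ≡ g x +₂ c
    from-cover (inj₁ ((y≈x , fy) , _))             = ⊥-elim (a≢0 (shift-vanishes f y≈x fy))
    from-cover (inj₂ (inj₁ (inj₁ (y~x , fy) , gy))) = y , y~x , fy , gy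
    from-cover (inj₂ (inj₁ (inj₂ (y≈x , _) , gy)))  = ⊥-elim (c≢0 (shift-vanishes g y≈x gy))
    from-cover (inj₂ (inj₂ ((y≈x , fy) , _)))      = ⊥-elim (a≢0 (shift-vanishes f y≈x fy))

  neighbour-unique : ∀ {x y y′} → _~_ G y x → _~_ G y′ x → f y ≡ f y′ → g y ≡ g y′ → y ≡ y′
  neighbour-unique {x} {y} {y′} y~x y′~x fy≡fy′ gy≡gy′ = codeword-unique ((x , f y) , g y)
    (ball-along-G (f y) (g y) y~x)
    (subst₂ (λ a b → Ball₁ L ((y′ , f y′) , g y′) ((x , a) , b)) (sym fy≡fy′) (sym gy≡gy′)
      (ball-along-G (f y′) (g y′) y′~x))

Σ₂-cong : ∀ n {h h′ : Fin n → E₂} → (∀ j → h j ≡ h′ j) → Σ₂ n h ≡ Σ₂ n h′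
Σ₂-cong zero    _ = refl
Σ₂-cong (suc n) p = cong₂ _+₂_ (p fz) (Σ₂-cong n (λ j → p (fs j)))

Σ₂-update : ∀ n (h h′ : Fin n → E₂) j → (∀ j′ → j′ ≢ j → h′ j′ ≡ h j′)
  → Σ₂ n h′ ≡ Σ₂ n h +₂ (h′ j +₂ h j)
Σ₂-update (suc n) h h′ fz agree = begin
  h′ fz +₂ Σ₂ n (λ j → h′ (fs j))       ≡⟨ cong (h′ fz +₂_) (Σ₂-cong n (λ j → agree (fs j) λ ())) ⟩
  h′ fz +₂ rest                          ≡⟨ +₂-comm (h′ fz) rest ⟩
  rest +₂ h′ fz                          ≡⟨ cong (rest +₂_) (+₂-cancelˡ (h fz) (h′ fz)) ⟨
  rest +₂ (h fz +₂ (h fz +₂ h′ fz))      ≡⟨ +₂-assoc rest (h fz) _ ⟨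
  (rest +₂ h fz) +₂ (h fz +₂ h′ fz)      ≡⟨ cong₂ _+₂_ (+₂-comm rest (h fz)) (+₂-comm (h fz) (h′ fz)) ⟩
  (h fz +₂ rest) +₂ (h′ fz +₂ h fz)      ∎
  where
  rest : E₂
  rest = Σ₂ n (λ j → h (fs j))
Σ₂-update (suc n) h h′ (fs j) agree = begin
  h′ fz +₂ Σ₂ n (λ j → h′ (fs j))                       ≡⟨ cong₂ _+₂_ (agree fz λ ())
                                                             (Σ₂-update n (λ j → h (fs j)) (λ j → h′ (fs j)) j
                                                               λ j′ j′≢j → agree (fs j′) λ e → j′≢j (suc-injective e)) ⟩
  h fz +₂ (Σ₂ n (λ j → h (fs j)) +₂ (h′ (fs j) +₂ h (fs j)))  ≡⟨ +₂-assoc (h fz) _ _ ⟨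
  (h fz +₂ Σ₂ n (λ j → h (fs j))) +₂ (h′ (fs j) +₂ h (fs j))  ∎

module Grid (k r : ℕ) (H : Fin k → Fin r → Graph) (H-discrete : ∀ i j → Discrete (H i j)) where

  GridGraph : Graph
  GridGraph = Πᴳ k (λ i → Πᴳ r (λ j → H i j))

  Position : Set
  Position = V GridGraph

  pointwise⇒≈ : ∀ {x y : Position} → (∀ i j → x i j ≡ y i j) → _≈_ GridGraph x y
  pointwise⇒≈ p i j = ≡⇒≈ (H-discrete i j) (p i j)

  ≈-reflᴳ : ∀ {x : Position} → _≈_ GridGraph x x
  ≈-reflᴳ = pointwise⇒≈ λ _ _ → refl

  ≈-sym : ∀ {x y : Position} → _≈_ GridGraph x y → _≈_ GridGraph y x
  ≈-sym e = pointwise⇒≈ λ i j → sym (≈⇒≡ (H-discrete i j) (e i j))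

  ≈-trans : ∀ {x y z : Position} → _≈_ GridGraph x y → _≈_ GridGraph y z → _≈_ GridGraph x z
  ≈-trans e e′ = pointwise⇒≈ λ i j → trans (≈⇒≡ (H-discrete i j) (e i j)) (≈⇒≡ (H-discrete i j) (e′ i j))

  Near : Position → Position → Fin k → Fin r → Set
  Near x′ x i j = _~_ (H i j) (x′ i j) (x i j) × (∀ i′ j′ → ¬ (i′ ≡ i × j′ ≡ j) → x′ i′ j′ ≡ x i′ j′)

  adjacent⇒near : ∀ {x′ x} → _~_ GridGraph x′ x → Σ (Fin k) λ i → Σ (Fin r) λ j → Near x′ x i j
  adjacent⇒near {x′} {x} (i , (j , moved , same-row) , other-rows) = i , j , moved , same
    where
    same : ∀ i′ j′ → ¬ (i′ ≡ i × j′ ≡ j) → x′ i′ j′ ≡ x i′ j′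
    same i′ j′ not-ij with i′ ≟ i
    ... | yes refl = ≈⇒≡ (H-discrete i j′) (same-row j′ λ j′≡j → not-ij (refl , j′≡j))
    ... | no i′≢i  = ≈⇒≡ (H-discrete i′ j′) (other-rows i′ i′≢i j′)

  near⇒adjacent : ∀ {x′ x i j} → Near x′ x i j → _~_ GridGraph x′ x
  near⇒adjacent {i = i} {j} (moved , same) =
    i , (j , moved , λ j′ j′≢j → ≡⇒≈ (H-discrete i j′) (same i j′ λ p → j′≢j (proj₂ p))) ,
    λ i′ i′≢i j′ → ≡⇒≈ (H-discrete i′ j′) (same i′ j′ λ p → i′≢i (proj₁ p))

  near-determined : ∀ {x₁ x₂ x i j} → Near x₁ x i j → Near x₂ x i j → x₁ i j ≡ x₂ i j → _≈_ GridGraph x₁ x₂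
  near-determined {x₁} {x₂} {x} {i} {j} (_ , same₁) (_ , same₂) e = pointwise⇒≈ agree
    where
    agree : ∀ i′ j′ → x₁ i′ j′ ≡ x₂ i′ j′
    agree i′ j′ with i′ ≟ i | j′ ≟ j
    ... | yes refl | yes refl = e
    ... | yes refl | no j′≢j  = trans (same₁ i j′ λ p → j′≢j (proj₂ p)) (sym (same₂ i j′ λ p → j′≢j (proj₂ p)))
    ... | no i′≢i  | _        = trans (same₁ i′ j′ λ p → i′≢i (proj₁ p)) (sym (same₂ i′ j′ λ p → i′≢i (proj₁ p)))

  _[_,_≔_] : Position → (i : Fin k) (j : Fin r) → V (H i j) → Position
  (x [ i , j ≔ y ]) i′ j′ with i′ ≟ i | j′ ≟ j
  ... | yes refl | yes refl = y
  ... | _        | _        = x i′ j′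

  update-here : ∀ x i j y → (x [ i , j ≔ y ]) i j ≡ y
  update-here x i j y with i ≟ i | j ≟ j
  ... | yes refl | yes refl = refl
  ... | yes refl | no j≢j   = ⊥-elim (j≢j refl)
  ... | no i≢i   | _        = ⊥-elim (i≢i refl)

  update-near : ∀ x {i j y} → _~_ (H i j) y (x i j) → Near (x [ i , j ≔ y ]) x i j
  update-near x {i} {j} {y} y~x = subst (λ z → _~_ (H i j) z (x i j)) (sym (update-here x i j y)) y~x , elsewhere
    where
    elsewhere : ∀ i′ j′ → ¬ (i′ ≡ i × j′ ≡ j) → (x [ i , j ≔ y ]) i′ j′ ≡ x i′ j′
    elsewhere i′ j′ not-ij with i′ ≟ i | j′ ≟ j
    ... | yes refl | yes refl = ⊥-elim (not-ij (refl , refl))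
    ... | yes refl | no _     = refl
    ... | no _     | _        = refl

  CellFunction : Set
  CellFunction = (i : Fin k) (j : Fin r) → V (H i j) → E₂

  rowSums : CellFunction → Position → E₂^ k
  rowSums h x = tabulate (λ i → Σ₂ r (λ j → h i j (x i j)))

  colSums : CellFunction → Position → E₂^ r
  colSums h x = tabulate (λ j → Σ₂ k (λ i → h i j (x i j)))

  rowSums-cong : ∀ h {x x′} → _≈_ GridGraph x x′ → rowSums h x ≡ rowSums h x′
  rowSums-cong h e = tabulate-cong λ i → Σ₂-cong r λ j → cong (h i j) (≈⇒≡ (H-discrete i j) (e i j))

  colSums-cong : ∀ h {x x′} → _≈_ GridGraph x x′ → colSums h x ≡ colSums h x′
  colSums-cong h e = tabulate-cong λ j → Σ₂-cong k λ i → cong (h i j) (≈⇒≡ (H-discrete i j) (e i j))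

  rowSums-near : ∀ h {x′ x i j} → Near x′ x i j
    → Step i (h i j (x′ i j) +₂ h i j (x i j)) (rowSums h x) (rowSums h x′)
  rowSums-near h {x′} {x} {i} {j} (_ , same) = step moved fixed
    where
    moved : lookup (rowSums h x′) i ≡ lookup (rowSums h x) i +₂ (h i j (x′ i j) +₂ h i j (x i j))
    moved = begin
      lookup (rowSums h x′) i                                  ≡⟨ lookup∘tabulate _ i ⟩
      Σ₂ r (λ j′ → h i j′ (x′ i j′))                            ≡⟨ Σ₂-update r _ _ j (λ j′ j′≢j → cong (h i j′) (same i j′ λ p → j′≢j (proj₂ p))) ⟩
      Σ₂ r (λ j′ → h i j′ (x i j′)) +₂ (h i j (x′ i j) +₂ h i j (x i j)) ≡⟨ cong (_+₂ _) (lookup∘tabulate _ i) ⟨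
      lookup (rowSums h x) i +₂ (h i j (x′ i j) +₂ h i j (x i j)) ∎
    fixed : ∀ i′ → i′ ≢ i → lookup (rowSums h x) i′ ≡ lookup (rowSums h x′) i′
    fixed i′ i′≢i = trans (lookup∘tabulate _ i′) (trans
      (Σ₂-cong r λ j′ → cong (h i′ j′) (sym (same i′ j′ λ p → i′≢i (proj₁ p))))
      (sym (lookup∘tabulate _ i′)))

  colSums-near : ∀ h {x′ x i j} → Near x′ x i j
    → Step j (h i j (x′ i j) +₂ h i j (x i j)) (colSums h x) (colSums h x′)
  colSums-near h {x′} {x} {i} {j} (_ , same) = step moved fixed
    where
    moved : lookup (colSums h x′) j ≡ lookup (colSums h x) j +₂ (h i j (x′ i j) +₂ h i j (x i j))
    moved = begin
      lookup (colSums h x′) j                                  ≡⟨ lookup∘tabulate _ j ⟩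
      Σ₂ k (λ i′ → h i′ j (x′ i′ j))                            ≡⟨ Σ₂-update k _ _ i (λ i′ i′≢i → cong (h i′ j) (same i′ j λ p → i′≢i (proj₁ p))) ⟩
      Σ₂ k (λ i′ → h i′ j (x i′ j)) +₂ (h i j (x′ i j) +₂ h i j (x i j)) ≡⟨ cong (_+₂ _) (lookup∘tabulate _ j) ⟨
      lookup (colSums h x) j +₂ (h i j (x′ i j) +₂ h i j (x i j)) ∎
    fixed : ∀ j′ → j′ ≢ j → lookup (colSums h x) j′ ≡ lookup (colSums h x′) j′
    fixed j′ j′≢j = trans (lookup∘tabulate _ j′) (trans
      (Σ₂-cong k λ i′ → cong (h i′ j′) (sym (same i′ j′ λ p → j′≢j (proj₂ p))))
      (sym (lookup∘tabulate _ j′)))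

module Construction (k r : ℕ) (S : Fin k → Fin r → Bool)
  (f g : (i : Fin k) (j : Fin r) → V (Gsel (S i j)) → E₂)
  (local-perfect : ∀ i j → IsPerfect1 (Gsel (S i j) ×ᴳ K ×ᴳ K) (GraphCode (Gsel (S i j)) (f i j) (g i j)))
  (C′ : E₂^ k → Set) (C′-perfect : IsPerfect1 (Kpow k) C′)
  (C″ : E₂^ r → Set) (C″-perfect : IsPerfect1 (Kpow r) C″) where

  open Grid k r (λ i j → Gsel (S i j)) (λ i j → Gsel-discrete (S i j))

  module Cell (i : Fin k) (j : Fin r) =
    NeighbourhoodBijection (Gsel (S i j)) (Gsel-discrete (S i j)) (Gsel-loopless (S i j))
      (f i j) (g i j) (local-perfect i j)

  Whole : Graph
  Whole = GridGraph ×ᴳ Kpow k ×ᴳ Kpow r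

  Code : V Whole → Set
  Code ((x , u) , w) = Σ (E₂^ k) λ c′ → Σ (E₂^ r) λ c″ →
    C′ c′ × C″ c″ × u ≡ rowSums f x ⊕ c′ × w ≡ colSums g x ⊕ c″

  position : V Whole → Position
  position ((x , _) , _) = x

  syndrome′ : V Whole → E₂^ k
  syndrome′ ((x , u) , _) = rowSums f x ⊕ u

  syndrome″ : V Whole → E₂^ r
  syndrome″ ((x , _) , w) = colSums g x ⊕ w

  syndromes⇒code : ∀ z → C′ (syndrome′ z) → C″ (syndrome″ z) → Code z
  syndromes⇒code ((x , u) , w) c′∈ c″∈ =
    _ , _ , c′∈ , c″∈ , sym (⊕-cancelˡ (rowSums f x) u) , sym (⊕-cancelˡ (colSums g x) w)

  code⇒syndromes : ∀ z → Code z → C′ (syndrome′ z) × C″ (syndrome″ z)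
  code⇒syndromes ((x , _) , _) (c′ , c″ , c′∈ , c″∈ , refl , refl) =
    subst C′ (sym (⊕-cancelˡ (rowSums f x) c′)) c′∈ , subst C″ (sym (⊕-cancelˡ (colSums g x) c″)) c″∈

  Δf Δg : ∀ {x′ x i j} → Near x′ x i j → E₂
  Δf {x′} {x} {i} {j} _ = f i j (x′ i j) +₂ f i j (x i j)
  Δg {x′} {x} {i} {j} _ = g i j (x′ i j) +₂ g i j (x i j)

  Δf-nonzero : ∀ {x′ x i j} (near : Near x′ x i j) → Δf near ≢ 0₂
  Δf-nonzero {i = i} {j} (moved , _) e = Cell.neighbour-changes-f i j moved (zero-difference e)

  Δg-nonzero : ∀ {x′ x i j} (near : Near x′ x i j) → Δg near ≢ 0₂
  Δg-nonzero {i = i} {j} (moved , _) e = Cell.neighbour-changes-g i j moved (zero-difference e)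

  syndrome′-near : ∀ {x′ x i j} (near : Near x′ x i j) u → Step i (Δf near) (rowSums f x ⊕ u) (rowSums f x′ ⊕ u)
  syndrome′-near near u = step-translateʳ u (rowSums-near f near)

  syndrome″-near : ∀ {x′ x i j} (near : Near x′ x i j) w → Step j (Δg near) (colSums g x ⊕ w) (colSums g x′ ⊕ w)
  syndrome″-near near w = step-translateʳ w (colSums-near g near)

  syndrome-ball : ∀ z v → Ball₁ Whole z v
    → Ball₁ (Kpow k) (syndrome′ z) (syndrome′ v) × Ball₁ (Kpow r) (syndrome″ z) (syndrome″ v)
  syndrome-ball ((x′ , u) , w) ((x , _) , _) (inj₁ ((x′≈x , refl) , refl)) =
    inj₁ (cong (_⊕ u) (rowSums-cong f x′≈x)) , inj₁ (cong (_⊕ w) (colSums-cong g x′≈x))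
  syndrome-ball ((x′ , u) , w) ((x , _) , _) (inj₂ (inj₁ (inj₁ (x′~x , refl) , refl)))
    with adjacent⇒near x′~x
  ... | _ , _ , near =
    inj₂ (Kpow-adjacent (Δf-nonzero near) (step-sym (syndrome′-near near u))) ,
    inj₂ (Kpow-adjacent (Δg-nonzero near) (step-sym (syndrome″-near near w)))
  syndrome-ball ((x′ , u′) , w) ((x , u) , _) (inj₂ (inj₁ (inj₂ (x′≈x , u′~u) , refl))) =
    inj₂ (subst (λ t → _~_ (Kpow k) (t ⊕ u′) (rowSums f x ⊕ u)) (rowSums-cong f (≈-sym x′≈x))
      (Kpow-translate (rowSums f x) u′~u)) ,
    inj₁ (cong (_⊕ w) (colSums-cong g x′≈x))
  syndrome-ball ((x′ , u) , w′) ((x , _) , w) (inj₂ (inj₂ ((x′≈x , refl) , w′~w))) =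
    inj₁ (cong (_⊕ u) (rowSums-cong f x′≈x)) ,
    inj₂ (subst (λ t → _~_ (Kpow r) (t ⊕ w′) (colSums g x ⊕ w)) (colSums-cong g (≈-sym x′≈x))
      (Kpow-translate (colSums g x) w′~w))

  data Shape : V Whole → V Whole → Set where
    position-fixed : ∀ {z v} → _≈_ GridGraph (position z) (position v)
      → syndrome′ z ≡ syndrome′ v ⊎ syndrome″ z ≡ syndrome″ v → Shape z v
    position-moved : ∀ {x′ x u w} i j → Near x′ x i j → Shape ((x′ , u) , w) ((x , u) , w)

  shape : ∀ z v → Ball₁ Whole z v → Shape z v
  shape ((x′ , u) , _) _ (inj₁ ((x′≈x , refl) , refl)) =
    position-fixed x′≈x (inj₁ (cong (_⊕ u) (rowSums-cong f x′≈x)))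
  shape _ _ (inj₂ (inj₁ (inj₁ (x′~x , refl) , refl))) with adjacent⇒near x′~x
  ... | i , j , near = position-moved i j near
  shape ((x′ , _) , w) _ (inj₂ (inj₁ (inj₂ (x′≈x , _) , refl))) =
    position-fixed x′≈x (inj₂ (cong (_⊕ w) (colSums-cong g x′≈x)))
  shape ((x′ , u) , _) _ (inj₂ (inj₂ ((x′≈x , refl) , _))) =
    position-fixed x′≈x (inj₁ (cong (_⊕ u) (rowSums-cong f x′≈x)))

  -- A moved vertex changes both syndromes, so it cannot share them with a
  -- vertex that keeps one of them.
  fixed-vs-moved : ∀ {x′ x i j u w} {s′ : E₂^ k} {s″ : E₂^ r} → Near x′ x i j
    → s′ ≡ rowSums f x ⊕ u ⊎ s″ ≡ colSums g x ⊕ w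
    → s′ ≡ rowSums f x′ ⊕ u → s″ ≡ colSums g x′ ⊕ w → ⊥
  fixed-vs-moved {u = u} near (inj₁ e) e′ _ = step-moves (Δf-nonzero near) (syndrome′-near near u) (trans (sym e) e′)
  fixed-vs-moved {w = w} near (inj₂ e) _ e″ = step-moves (Δg-nonzero near) (syndrome″-near near w) (trans (sym e) e″)

  -- Two moves with the same syndromes happen in the same cell with the same
  -- shifts of f and g, hence (by the local bijection) to the same position.
  moved-positions-agree : ∀ {x₁ x₂ x u w i j i′ j′} (near₁ : Near x₁ x i j) (near₂ : Near x₂ x i′ j′)
    → rowSums f x₁ ⊕ u ≡ rowSums f x₂ ⊕ u → colSums g x₁ ⊕ w ≡ colSums g x₂ ⊕ w
    → _≈_ GridGraph x₂ x₁
  moved-positions-agree {u = u} {w} near₁ near₂ same′ same″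
    with step-unique (Δf-nonzero near₁) (syndrome′-near near₁ u)
           (subst (Step _ _ _) (sym same′) (syndrome′-near near₂ u))
       | step-unique (Δg-nonzero near₁) (syndrome″-near near₁ w)
           (subst (Step _ _ _) (sym same″) (syndrome″-near near₂ w))
  ... | refl , same-Δf | refl , same-Δg =
    near-determined near₂ near₁
      (sym (Cell.neighbour-unique _ _ (proj₁ near₁) (proj₁ near₂) (+₂-injectiveʳ same-Δf) (+₂-injectiveʳ same-Δg)))

  positions-agree : ∀ z z′ v → syndrome′ z ≡ syndrome′ z′ → syndrome″ z ≡ syndrome″ z′
    → Shape z v → Shape z′ v → _≈_ GridGraph (position z′) (position z)
  positions-agree _ _ _ _ _ (position-fixed z≈v _) (position-fixed z′≈v _) = ≈-trans z′≈v (≈-sym z≈v)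
  positions-agree _ _ _ same′ same″ (position-fixed _ kept) (position-moved _ _ near′) =
    ⊥-elim (fixed-vs-moved near′ kept same′ same″)
  positions-agree _ _ _ same′ same″ (position-moved _ _ near) (position-fixed _ kept) =
    ⊥-elim (fixed-vs-moved near kept (sym same′) (sym same″))
  positions-agree _ _ _ same′ same″ (position-moved _ _ near) (position-moved _ _ near′) =
    moved-positions-agree near near′ same′ same″

  syndromes-determine : ∀ z z′ → _≈_ GridGraph (position z) (position z′)
    → syndrome′ z ≡ syndrome′ z′ → syndrome″ z ≡ syndrome″ z′ → _≈_ Whole z z′
  syndromes-determine ((x , u) , w) ((x′ , u′) , w′) x≈x′ same′ same″ =
    (x≈x′ , ⊕-injectiveʳ (trans same′ (cong (_⊕ u′) (sym (rowSums-cong f x≈x′))))) ,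
    ⊕-injectiveʳ (trans same″ (cong (_⊕ w′) (sym (colSums-cong g x≈x′))))

  -- Codewords in a common ball have equal syndromes (by the packing of C′ and
  -- C″), hence equal positions, hence they coincide.
  packing : ∀ {z z′ v} → Code z → Code z′ → Ball₁ Whole z v → Ball₁ Whole z′ v → _≈_ Whole z′ z
  packing {z} {z′} {v} z∈ z′∈ ball ball′ =
    syndromes-determine z′ z (positions-agree z z′ v same′ same″ (shape z v ball) (shape z′ v ball′))
      (sym same′) (sym same″)
    where
    same′ : syndrome′ z ≡ syndrome′ z′
    same′ = perfect⇒packing (Kpow-discrete k) C′-perfect
      (proj₁ (code⇒syndromes z z∈)) (proj₁ (code⇒syndromes z′ z′∈))
      (proj₁ (syndrome-ball z v ball)) (proj₁ (syndrome-ball z′ v ball′))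
    same″ : syndrome″ z ≡ syndrome″ z′
    same″ = perfect⇒packing (Kpow-discrete r) C″-perfect
      (proj₂ (code⇒syndromes z z∈)) (proj₂ (code⇒syndromes z′ z′∈))
      (proj₂ (syndrome-ball z v ball)) (proj₂ (syndrome-ball z′ v ball′))

  -- Let c′, c″ be the codewords of C′, C″ nearest to the two
  -- syndromes of v = (x , u , w); the covering codeword depends on whether
  -- each of them equals or is adjacent to its syndrome.
  Covered : V Whole → Set
  Covered v = Σ (V Whole) λ z → Code z × Ball₁ Whole z v

  cover-at-centre : ∀ x u w → C′ (rowSums f x ⊕ u) → C″ (colSums g x ⊕ w) → Covered ((x , u) , w)
  cover-at-centre x u w c′∈ c″∈ =
    ((x , u) , w) , syndromes⇒code ((x , u) , w) c′∈ c″∈ , inj₁ ((≈-reflᴳ , refl) , refl)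

  cover-along-u : ∀ x u w {c′} → C′ c′ → _~_ (Kpow k) c′ (rowSums f x ⊕ u) → C″ (colSums g x ⊕ w)
    → Covered ((x , u) , w)
  cover-along-u x u w {c′} c′∈ c′~s c″∈ =
    ((x , rowSums f x ⊕ c′) , w) ,
    syndromes⇒code ((x , rowSums f x ⊕ c′) , w) (subst C′ (sym (⊕-cancelˡ (rowSums f x) c′)) c′∈) c″∈ ,
    inj₂ (inj₁ (inj₂ (≈-reflᴳ , u-adjacent) , refl))
    where
    u-adjacent : _~_ (Kpow k) (rowSums f x ⊕ c′) u
    u-adjacent = subst (_~_ (Kpow k) (rowSums f x ⊕ c′)) (⊕-cancelˡ (rowSums f x) u) (Kpow-translate (rowSums f x) c′~s)

  cover-along-w : ∀ x u w {c″} → C′ (rowSums f x ⊕ u) → C″ c″ → _~_ (Kpow r) c″ (colSums g x ⊕ w)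
    → Covered ((x , u) , w)
  cover-along-w x u w {c″} c′∈ c″∈ c″~s =
    ((x , u) , colSums g x ⊕ c″) ,
    syndromes⇒code ((x , u) , colSums g x ⊕ c″) c′∈ (subst C″ (sym (⊕-cancelˡ (colSums g x) c″)) c″∈) ,
    inj₂ (inj₂ ((≈-reflᴳ , refl) , w-adjacent))
    where
    w-adjacent : _~_ (Kpow r) (colSums g x ⊕ c″) w
    w-adjacent = subst (_~_ (Kpow r) (colSums g x ⊕ c″)) (⊕-cancelˡ (colSums g x) w) (Kpow-translate (colSums g x) c″~s)

  -- Both syndromes are off, in coordinates i and j by d and e: move the
  -- position in cell (i , j) to the neighbour with shifts (d , e).
  cover-by-move : ∀ x u w {c′ c″} → C′ c′ → _~_ (Kpow k) c′ (rowSums f x ⊕ u)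
    → C″ c″ → _~_ (Kpow r) c″ (colSums g x ⊕ w) → Covered ((x , u) , w)
  cover-by-move x u w {c′} {c″} c′∈ c′~s c″∈ c″~s
    with Kpow-adjacent⁻¹ c′~s | Kpow-adjacent⁻¹ c″~s
  ... | i , d , d≢0 , c′-step | j , e , e≢0 , c″-step
    with Cell.neighbour-exists i j (x i j) d≢0 e≢0
  ... | y , y~x , fy , gy =
    ((x* , u) , w) ,
    syndromes⇒code ((x* , u) , w) (subst C′ (sym syndrome′≡c′) c′∈) (subst C″ (sym syndrome″≡c″) c″∈) ,
    inj₂ (inj₁ (inj₁ (near⇒adjacent near , refl) , refl))
    where
    x* : Position
    x* = x [ i , j ≔ y ]
    near : Near x* x i j
    near = update-near x y~x
    Δf≡d : Δf near ≡ d
    Δf≡d = trans (cong (λ t → f i j t +₂ f i j (x i j)) (update-here x i j y)) (difference fy)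
    Δg≡e : Δg near ≡ e
    Δg≡e = trans (cong (λ t → g i j t +₂ g i j (x i j)) (update-here x i j y)) (difference gy)
    syndrome′≡c′ : rowSums f x* ⊕ u ≡ c′
    syndrome′≡c′ = step-determined (subst (λ δ → Step i δ _ _) Δf≡d (syndrome′-near near u)) (step-sym c′-step)
    syndrome″≡c″ : colSums g x* ⊕ w ≡ c″
    syndrome″≡c″ = step-determined (subst (λ δ → Step j δ _ _) Δg≡e (syndrome″-near near w)) (step-sym c″-step)

  covering : ∀ v → Covered v
  covering ((x , u) , w) with C′-perfect (rowSums f x ⊕ u) | C″-perfect (colSums g x ⊕ w)
  ... | _ , (c′∈ , inj₁ refl) , _ | _ , (c″∈ , inj₁ refl) , _ = cover-at-centre x u w c′∈ c″∈
  ... | _ , (c′∈ , inj₂ c′~s) , _ | _ , (c″∈ , inj₁ refl) , _ = cover-along-u x u w c′∈ c′~s c″∈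
  ... | _ , (c′∈ , inj₁ refl) , _ | _ , (c″∈ , inj₂ c″~s) , _ = cover-along-w x u w c′∈ c″∈ c″~s
  ... | _ , (c′∈ , inj₂ c′~s) , _ | _ , (c″∈ , inj₂ c″~s) , _ = cover-by-move x u w c′∈ c′~s c″∈ c″~s

  perfect : IsPerfect1 Whole Code
  perfect = covering+packing⇒perfect covering packing

lemma3 : (k r m : ℕ) → 1 ≤ k → 1 ≤ r
  → (S : Fin k → Fin r → Bool) → countS k r S ≡ m
  → (f g : (i : Fin k) → (j : Fin r) → V (Gsel (S i j)) → E₂)
  → ((i : Fin k) → (j : Fin r) →
       IsPerfect1 (Gsel (S i j) ×ᴳ K ×ᴳ K) (GraphCode (Gsel (S i j)) (f i j) (g i j)))
  → (C′ : E₂^ k → Set) → IsPerfect1 (Kpow k) C′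
  → (C″ : E₂^ r → Set) → IsPerfect1 (Kpow r) C″
  → IsPerfect1
      (Πᴳ k (λ i → Πᴳ r (λ j → Gsel (S i j))) ×ᴳ Kpow k ×ᴳ Kpow r)
      (λ { ((x , u) , w) → Σ (E₂^ k) (λ c′ → Σ (E₂^ r) (λ c″ →
          C′ c′ × C″ c″
          × u ≡ tabulate (λ i → Σ₂ r (λ j → f i j (x i j))) ⊕ c′
          × w ≡ tabulate (λ j → Σ₂ k (λ i → g i j (x i j))) ⊕ c″)) })
lemma3 k r _ _ _ S _ f g local-perfect C′ C′-perfect C″ C″-perfect =
  Construction.perfect k r S f g local-perfect C′ C′-perfect C″ C″-perfect
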